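{- Let $G_2$ be the graph consisting of a $5$-cycle $C_2=v_1u_2v_3u_4u_5$ (edges $v_1u_2,u_2v_3,v_3u_4,u_4u_5,u_5v_1$), a vertex $y_1$ adjacent to all five vertices of $C_2$, a triangle $y_2y_3y_4$, and the edge $y_1y_2$. Let $G_3$ be obtained from $G_2$ by adding, for each $i\in\{1,2\}$, new vertices $z_{i,1},\dots,z_{i,7}$; the edges $y_4z_{i,1}$ and $y_4z_{i,2}$; the edge $z_{i,j}z_{i,k}$ for all $1\le j<k\le 4$ with $(j,k)\neq(1,2)$; the edges of the triangle $z_{i,5}z_{i,6}z_{i,7}$; and the edge $z_{i,4}z_{i,5}$. Define $L_3$ by $L_3(v)=\{1,\dots,6\}$ for $v\in V(C_2)$, $L_3(y_1)=\{1,\dots,8\}$, $L_3(y_2)=L_3(y_4)=\{1,2,3,4,7,8\}$, $L_3(y_3)=\{1,2,3,4\}$, and for $i\in\{1,2\}$: $L_3(z_{i,1})=\{1,2,3,6+i\}$, $L_3(z_{i,2})=\{4,5,6,6+i\}$, $L_3(z_{i,3})=\{1,\dots,6\}$, $L_3(z_{i,4})=\{1,\dots,8\}$, $L_3(z_{i,5})=L_3(z_{i,7})=\{1,2,3,4,7,8\}$, $L_3(z_{i,6})=\{1,2,3,4\}$. Then the gadget $(G_3,L_3)$ is $(v_1,v_3,\{z_{1,7},z_{2,7}\})$-relaxed, and every $(L_3:2)$-coloring $\varphi$ of $G_3$ satisfies $\varphi(z_{1,7})=\{7,8\}$ or $\varphi(z_{2,7})=\{7,8\}$.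
   Context: A list assignment $L$ for a graph $G$ assigns to each vertex $v$ a set $L(v)$ of colors. An $L$-coloring of $G$ is a proper vertex coloring $c$ with $c(v)\in L(v)$ for all $v$. For $S\subseteq V(G)$, an $L$-coloring of $S$ is an $L$-coloring of the induced subgraph $G[S]$; if $S\subseteq S'$ and $\varphi'$ is an $L$-coloring of $S'$, then $\varphi'$ extends an $L$-coloring $\varphi$ of $S$ if $\varphi'|_S=\varphi$. An $(L:2)$-coloring assigns to each vertex $v$ a $2$-element subset $\varphi(v)\subseteq L(v)$ such that adjacent vertices receive disjoint sets. A gadget is a pair $(G,L_0)$ where $L_0$ is a list assignment with all lists of even size; a half-list assignment for $(G,L_0)$ is any list assignment $L$ with $|L(v)|=|L_0(v)|/2$ for all $v$. For distinct vertices $v_1,v_3$ and a set $S\subseteq V(G)\setminus\{v_1,v_3\}$, the gadget is $(v_1,v_3,S)$-relaxed if every half-list assignment $L$ satisfies at least one of: (i) there is an $L$-coloring $\psi_0$ of $\{v_1,v_3\}$ such that every $L$-coloring of $S\cup\{v_1,v_3\}$ extending $\psi_0$ extends to an $L$-coloring of $G$; (ii) $L(v_1)=L(v_3)$ and there is an $L$-coloring $\psi_0$ of $S$ such that every $L$-coloring of $S\cup\{v_1,v_3\}$ extending $\psi_0$ extends to an $L$-coloring of $G$. -}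

module Defs where

open import Data.Nat using (ℕ; _+_; _*_; _<_)
open import Data.List using (List; []; _∷_; _++_; length)
open import Data.List.Membership.Propositional using (_∈_)
open import Data.List.Relation.Unary.Unique.Propositional using (Unique)
open import Data.Product using (Σ; ∃; _×_; _,_)
open import Data.Sum using (_⊎_)
open import Relation.Binary.PropositionalEquality using (_≡_; _≢_)
open import Relation.Nullary using (¬_)

VSet : Set → Set₁
VSet V = V → Set

-- φ is an L-coloring of the induced subgraph G[S]
-- (c is a total function, but only its values on S matter)
IsLColoringOn : {V : Set} → (Adj : V → V → Set) → (L : V → List ℕ) →
                VSet V → (V → ℕ) → Set
IsLColoringOn Adj L S c =
  (∀ v → S v → c v ∈ L v) ×
  (∀ u v → S u → S v → Adj u v → c u ≢ c v)

IsLColoring : {V : Set} → (Adj : V → V → Set) → (L : V → List ℕ) →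
              (V → ℕ) → Set
IsLColoring Adj L c = (∀ v → c v ∈ L v) × (∀ u v → Adj u v → c u ≢ c v)

AgreeOn : {V : Set} → VSet V → (V → ℕ) → (V → ℕ) → Set
AgreeOn S c c' = ∀ v → S v → c v ≡ c' v

_∪_ : {V : Set} → VSet V → VSet V → VSet V
(S ∪ T) v = S v ⊎ T v

pair : {V : Set} → V → V → VSet V
pair a b v = (v ≡ a) ⊎ (v ≡ b)

IsHalfList : {V : Set} → (L0 L : V → List ℕ) → Set
IsHalfList L0 L = ∀ v → Unique (L v) × (length (L v) * 2 ≡ length (L0 v))

SameSet : List ℕ → List ℕ → Set
SameSet A B = ∀ x → (x ∈ A → x ∈ B) × (x ∈ B → x ∈ A)

Relaxed : {V : Set} → (Adj : V → V → Set) → (L0 : V → List ℕ) →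
          V → V → VSet V → Set
Relaxed {V} Adj L0 a b S =
  ∀ (L : V → List ℕ) → IsHalfList L0 L →
    (Σ (V → ℕ) λ ψ0 → IsLColoringOn Adj L (pair a b) ψ0 ×
       (∀ ψ → IsLColoringOn Adj L (S ∪ pair a b) ψ → AgreeOn (pair a b) ψ0 ψ →
          Σ (V → ℕ) λ c → IsLColoring Adj L c × AgreeOn (S ∪ pair a b) ψ c))
    ⊎
    (SameSet (L a) (L b) ×
     Σ (V → ℕ) λ ψ0 → IsLColoringOn Adj L S ψ0 ×
       (∀ ψ → IsLColoringOn Adj L (S ∪ pair a b) ψ → AgreeOn S ψ0 ψ →
          Σ (V → ℕ) λ c → IsLColoring Adj L c × AgreeOn (S ∪ pair a b) ψ c))

-- (L:2)-coloring: each vertex gets a 2-element subset {a , b} ⊆ L(v),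
-- represented canonically as the pair (a , b) with a < b;
-- adjacent vertices get disjoint sets
Is2Coloring : {V : Set} → (Adj : V → V → Set) → (L : V → List ℕ) →
              (V → ℕ × ℕ) → Set
Is2Coloring {V} Adj L φ =
  (∀ v → let (a , b) = φ v in a < b × a ∈ L v × b ∈ L v) ×
  (∀ u v → Adj u v → ∀ x → let (a , b) = φ u ; (c , d) = φ v in
      (x ≡ a ⊎ x ≡ b) → ¬ (x ≡ c ⊎ x ≡ d))

data I : Set where
  i1 i2 : I

data J : Set where
  j1 j2 j3 j4 j5 j6 j7 : J

data V : Set where
  v1 u2 v3 u4 u5 y1 y2 y3 y4 : V
  z : I → J → V

idx : I → ℕ
idx i1 = 1
idx i2 = 2

edgesG2 : List (V × V)
edgesG2 =
  (v1 , u2) ∷ (u2 , v3) ∷ (v3 , u4) ∷ (u4 , u5) ∷ (u5 , v1) ∷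
  (y1 , v1) ∷ (y1 , u2) ∷ (y1 , v3) ∷ (y1 , u4) ∷ (y1 , u5) ∷
  (y2 , y3) ∷ (y3 , y4) ∷ (y2 , y4) ∷
  (y1 , y2) ∷ []

edgesZ : I → List (V × V)
edgesZ i =
  (y4 , z i j1) ∷ (y4 , z i j2) ∷
  (z i j1 , z i j3) ∷ (z i j1 , z i j4) ∷ (z i j2 , z i j3) ∷
  (z i j2 , z i j4) ∷ (z i j3 , z i j4) ∷
  (z i j5 , z i j6) ∷ (z i j6 , z i j7) ∷ (z i j5 , z i j7) ∷
  (z i j4 , z i j5) ∷ []

edgesG3 : List (V × V)
edgesG3 = edgesG2 ++ edgesZ i1 ++ edgesZ i2

Adj3 : V → V → Set
Adj3 u v = ((u , v) ∈ edgesG3) ⊎ ((v , u) ∈ edgesG3)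

L3 : V → List ℕ
L3 v1 = 1 ∷ 2 ∷ 3 ∷ 4 ∷ 5 ∷ 6 ∷ []
L3 u2 = 1 ∷ 2 ∷ 3 ∷ 4 ∷ 5 ∷ 6 ∷ []
L3 v3 = 1 ∷ 2 ∷ 3 ∷ 4 ∷ 5 ∷ 6 ∷ []
L3 u4 = 1 ∷ 2 ∷ 3 ∷ 4 ∷ 5 ∷ 6 ∷ []
L3 u5 = 1 ∷ 2 ∷ 3 ∷ 4 ∷ 5 ∷ 6 ∷ []
L3 y1 = 1 ∷ 2 ∷ 3 ∷ 4 ∷ 5 ∷ 6 ∷ 7 ∷ 8 ∷ []
L3 y2 = 1 ∷ 2 ∷ 3 ∷ 4 ∷ 7 ∷ 8 ∷ []
L3 y3 = 1 ∷ 2 ∷ 3 ∷ 4 ∷ []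
L3 y4 = 1 ∷ 2 ∷ 3 ∷ 4 ∷ 7 ∷ 8 ∷ []
L3 (z i j1) = 1 ∷ 2 ∷ 3 ∷ (6 + idx i) ∷ []
L3 (z i j2) = 4 ∷ 5 ∷ 6 ∷ (6 + idx i) ∷ []
L3 (z i j3) = 1 ∷ 2 ∷ 3 ∷ 4 ∷ 5 ∷ 6 ∷ []
L3 (z i j4) = 1 ∷ 2 ∷ 3 ∷ 4 ∷ 5 ∷ 6 ∷ 7 ∷ 8 ∷ []
L3 (z i j5) = 1 ∷ 2 ∷ 3 ∷ 4 ∷ 7 ∷ 8 ∷ []
L3 (z i j6) = 1 ∷ 2 ∷ 3 ∷ 4 ∷ []
L3 (z i j7) = 1 ∷ 2 ∷ 3 ∷ 4 ∷ 7 ∷ 8 ∷ []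

S3 : VSet V
S3 = pair (z i1 j7) (z i2 j7)

-- Let r be a colour of y2 that y3 cannot use. Each z-gadget has a colour d*ᵢ such that
-- it can be completed around any colour c of z_{i,7} as soon as y4 avoids d*ᵢ or c ∉ L(z_{i,6}).
-- If y1 has a colour y ≠ r missing from some rim list, the 5-cycle can be coloured avoiding y;
-- this fixes v1 and v3, and y4 avoids d*₁ and d*₂ (option (i)). Otherwise every rim list is
-- L(y1) ∖ {r}, so L(v1) = L(v3), y1 takes r, and precolouring each z_{i,7} outside L(z_{i,6})
-- leaves y4 free (option (ii)).
--
-- Three pairwise disjoint 2-sets inside a 6-set cover it. Applied to the triangles
-- u2 v3 y1 and u5 u4 y1 this shows that y1 uses 7 or 8, and the triangle y2 y3 y4 passes that
-- colour 6 + i on to y4. Then z_{i,1} ⊆ {1,2,3} and z_{i,2} ⊆ {4,5,6}, so z_{i,1}, z_{i,2}, z_{i,3}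
-- use up {1,…,6}, z_{i,4} = {7,8}, and the triangle z_{i,5} z_{i,6} z_{i,7} forces z_{i,7} = {7,8}.

module Submission where

open import Data.Nat using (ℕ; zero; suc; _≟_; _+_; _*_; ⌊_/2⌋; _≤_; _<_; z≤n; s≤s; _<?_)
open import Data.Nat.Properties using (≤-refl; <-irrefl; <-asym; <⇒≢; ≤⇒≯; <⇒≱; 1+n≰n; ≤-reflexive; module ≤-Reasoning)
open import Data.List using (List; []; _∷_; _++_; length; lookup)
open import Data.List.Properties using (length-removeAt′; length-++)
open import Data.List.Membership.Propositional using (_∈_; _∉_; _─_; find; lose)
open import Data.List.Membership.Propositional.Properties using (∈-++⁻; ∈-++⁺ˡ; ∈-++⁺ʳ; ∈-lookup)
open import Data.List.Relation.Unary.Any using (Any; here; there; index; any?)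
open import Data.List.Relation.Unary.All as All using (All; []; _∷_)
open import Data.List.Relation.Unary.All.Properties using (¬Any⇒All¬) renaming (++⁺ to All-++⁺)
open import Data.List.Relation.Unary.AllPairs using ([]; _∷_)
open import Data.List.Relation.Unary.Unique.Propositional using (Unique)
open import Data.List.Relation.Unary.Unique.Propositional.Properties using (++⁺)
open import Data.List.Relation.Binary.Subset.Propositional using (_⊆_)
open import Data.List.Relation.Binary.Disjoint.Propositional using (Disjoint)
open import Data.Product using (Σ; ∃-syntax; _×_; _,_; proj₁; proj₂)
open import Data.Sum using (_⊎_; inj₁; inj₂; [_,_]′; swap)
open import Data.Fin using (Fin; #_)
open import Data.Empty using (⊥-elim)
open import Function using (_∘_)
open import Relation.Binary.Definitions using (DecidableEquality)
open import Relation.Binary.PropositionalEquality using (_≡_; _≢_; refl; sym; trans; cong; cong₂; subst; subst₂; ≢-sym)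
open import Relation.Nullary using (¬_; yes; no; ¬?; contradiction)
open import Relation.Nullary.Decidable using (True; toWitness; decidable-stable)

open import Defs

n≡⌊n*2/2⌋ : ∀ n → n ≡ ⌊ n * 2 /2⌋
n≡⌊n*2/2⌋ zero    = refl
n≡⌊n*2/2⌋ (suc n) = cong suc (n≡⌊n*2/2⌋ n)

module _ {a} {A : Set a} where

  Sized : ℕ → List A → Set a
  Sized n xs = Unique xs × length xs ≡ n

  ∈-─⁺ : ∀ {x y : A} {xs} (x∈xs : x ∈ xs) → y ∈ xs → y ≢ x → y ∈ xs ─ x∈xs
  ∈-─⁺ (here refl)  (here refl)  y≢x = ⊥-elim (y≢x refl)
  ∈-─⁺ (here _)     (there y∈xs) _   = y∈xs
  ∈-─⁺ (there _)    (here refl)  _   = here refl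
  ∈-─⁺ (there x∈xs) (there y∈xs) y≢x = there (∈-─⁺ x∈xs y∈xs y≢x)

  Unique-⊆⇒length≤ : ∀ {xs ys : List A} → Unique xs → xs ⊆ ys → length xs ≤ length ys
  Unique-⊆⇒length≤ [] _ = z≤n
  Unique-⊆⇒length≤ {x ∷ xs} {ys} (x≢xs ∷ xs!) x∷xs⊆ys = begin
    suc (length xs)          ≤⟨ s≤s (Unique-⊆⇒length≤ xs! xs⊆ys─x) ⟩
    suc (length (ys ─ x∈ys)) ≡⟨ length-removeAt′ ys (index x∈ys) ⟨
    length ys                ∎
    where
    open ≤-Reasoning
    x∈ys : x ∈ ys
    x∈ys = x∷xs⊆ys (here refl)
    xs⊆ys─x : xs ⊆ ys ─ x∈ys
    xs⊆ys─x y∈xs = ∈-─⁺ x∈ys (x∷xs⊆ys (there y∈xs)) (≢-sym (All.lookup x≢xs y∈xs))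

  ∈-++⁻-∉ʳ : ∀ {x : A} xs {ys} → x ∈ xs ++ ys → x ∉ ys → x ∈ xs
  ∈-++⁻-∉ʳ xs x∈ x∉ys = [ (λ x∈xs → x∈xs) , (λ x∈ys → contradiction x∈ys x∉ys) ]′ (∈-++⁻ xs x∈)

  ∈-++⁻-∉ˡ : ∀ {x : A} xs {ys} → x ∈ xs ++ ys → x ∉ xs → x ∈ ys
  ∈-++⁻-∉ˡ xs x∈ x∉xs = [ (λ x∈xs → contradiction x∈xs x∉xs) , (λ x∈ys → x∈ys) ]′ (∈-++⁻ xs x∈)

  ∈∧∉⇒≢ : ∀ {x y : A} {xs} → x ∈ xs → y ∉ xs → x ≢ y
  ∈∧∉⇒≢ x∈xs y∉xs refl = y∉xs x∈xs

module DecidableLists {a} {A : Set a} (_≟_ : DecidableEquality A) where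

  open import Data.List.Membership.DecPropositional _≟_ using (_∈?_)

  ⊆-or-∃∉ : (xs ys : List A) → xs ⊆ ys ⊎ ∃[ x ] x ∈ xs × x ∉ ys
  ⊆-or-∃∉ xs ys with any? (λ x → ¬? (x ∈? ys)) xs
  ... | yes escapee = inj₂ (find escapee)
  ... | no  none    = inj₁ λ x∈xs → decidable-stable (_ ∈? ys) (none ∘ lose x∈xs)

  length<⇒∃∉ : ∀ {xs ys : List A} → Unique xs → length ys < length xs → ∃[ x ] x ∈ xs × x ∉ ys
  length<⇒∃∉ {xs} {ys} xs! ys<xs with ⊆-or-∃∉ xs ys
  ... | inj₂ escapee = escapee
  ... | inj₁ xs⊆ys   = contradiction (Unique-⊆⇒length≤ xs! xs⊆ys) (<⇒≱ ys<xs)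

  ⊆∧length≤⇒⊇ : ∀ {xs ys : List A} → Unique xs → xs ⊆ ys → length ys ≤ length xs → ys ⊆ xs
  ⊆∧length≤⇒⊇ {xs} {ys} xs! xs⊆ys ys≤xs {y} y∈ys with y ∈? xs
  ... | yes y∈xs = y∈xs
  ... | no  y∉xs = contradiction (Unique-⊆⇒length≤ y∷xs! y∷xs⊆ys) (≤⇒≯ ys≤xs)
    where
    y∷xs! : Unique (y ∷ xs)
    y∷xs! = ¬Any⇒All¬ xs y∉xs ∷ xs!
    y∷xs⊆ys : y ∷ xs ⊆ ys
    y∷xs⊆ys (here refl) = y∈ys
    y∷xs⊆ys (there y′∈xs) = xs⊆ys y′∈xs

  ⊆-∷⇒∉×⊇ : ∀ {n r} {ys bs : List A} → Sized (suc n) ys → length bs ≡ n →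
            ys ⊆ r ∷ bs → r ∉ bs × r ∷ bs ⊆ ys
  ⊆-∷⇒∉×⊇ {n} {r} {ys} {bs} (ys! , ∣ys∣) ∣bs∣ ys⊆r∷bs = r∉bs , r∷bs⊆ys
    where
    r∉bs : r ∉ bs
    r∉bs r∈bs = 1+n≰n (subst₂ _≤_ ∣ys∣ ∣bs∣ (Unique-⊆⇒length≤ ys! ys⊆bs))
      where
      ys⊆bs : ys ⊆ bs
      ys⊆bs y∈ys with ys⊆r∷bs y∈ys
      ... | here refl = r∈bs
      ... | there y∈bs = y∈bs
    r∷bs⊆ys : r ∷ bs ⊆ ys
    r∷bs⊆ys = ⊆∧length≤⇒⊇ ys! ys⊆r∷bs (≤-reflexive (trans (cong suc ∣bs∣) (sym ∣ys∣)))

  ∈-third : ∀ {P Q S R : List A} {x} → Unique P → Unique Q → Unique S →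
            Disjoint P Q → Disjoint P S → Disjoint Q S →
            P ⊆ R → Q ⊆ R → S ⊆ R → length R ≤ length (P ++ Q ++ S) →
            x ∈ R → x ∉ P → x ∉ Q → x ∈ S
  ∈-third {P} {Q} {S} {R} P! Q! S! P#Q P#S Q#S P⊆R Q⊆R S⊆R ∣R∣≤ x∈R x∉P x∉Q =
    ∈-++⁻-∉ˡ Q (∈-++⁻-∉ˡ P (⊆∧length≤⇒⊇ PQS! PQS⊆R ∣R∣≤ x∈R) x∉P) x∉Q
    where
    PQS! : Unique (P ++ Q ++ S)
    PQS! = ++⁺ P! (++⁺ Q! S! Q#S) λ (x∈P , x∈QS) →
      [ (λ x∈Q → P#Q (x∈P , x∈Q)) , (λ x∈S → P#S (x∈P , x∈S)) ]′ (∈-++⁻ Q x∈QS)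
    PQS⊆R : P ++ Q ++ S ⊆ R
    PQS⊆R x∈PQS = [ P⊆R , [ Q⊆R , S⊆R ]′ ∘ ∈-++⁻ Q ]′ (∈-++⁻ P x∈PQS)

  pickAvoiding : ∀ {n} {xs : List A} → Sized n xs → (ys : List A) → {_ : True (length ys <? n)} →
                 ∃[ x ] x ∈ xs × All (x ≢_) ys
  pickAvoiding (xs! , refl) ys {ys<n} with length<⇒∃∉ xs! (toWitness ys<n)
  ... | x , x∈xs , x∉ys = x , x∈xs , ¬Any⇒All¬ ys x∉ys

  pickOutside : ∀ {m n} {xs ys : List A} → Sized m xs → length ys ≡ n → {_ : True (n <? m)} →
                ∃[ x ] x ∈ xs × x ∉ ys
  pickOutside (xs! , refl) refl {n<m} = length<⇒∃∉ xs! (toWitness n<m)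

open DecidableLists _≟_
open import Data.List.Membership.DecPropositional _≟_ using (_∈?_; _∉?_)

record EdgeColouring (P Q : List ℕ) (y w : ℕ) : Set where
  field
    p q : ℕ
    p∈P : p ∈ P
    q∈Q : q ∈ Q
    p≢y : p ≢ y
    p≢w : p ≢ w
    q≢w : q ≢ w
    p≢q : p ≢ q

-- If w ∈ Q, the colour r ∈ P ∖ Q can be given to p: it differs from w and from every colour of Q.
edgeColouring : ∀ {P Q r} → Sized 3 P → Sized 2 Q → r ∈ P → r ∉ Q →
                ∀ y w → y ≢ r ⊎ w ∉ Q → EdgeColouring P Q y w
edgeColouring {Q = Q} {r} P₃ Q₂ r∈P r∉Q y w escape with w ∈? Q | escape
... | yes w∈Q | inj₂ w∉Q = contradiction w∈Q w∉Q
... | yes w∈Q | inj₁ y≢r with pickAvoiding Q₂ (w ∷ [])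
...   | q , q∈Q , q≢w ∷ [] = record
        { p = r ; q = q ; p∈P = r∈P ; q∈Q = q∈Q ; p≢y = ≢-sym y≢r
        ; p≢w = ≢-sym (∈∧∉⇒≢ w∈Q r∉Q) ; q≢w = q≢w ; p≢q = ≢-sym (∈∧∉⇒≢ q∈Q r∉Q) }
edgeColouring P₃ Q₂ r∈P r∉Q y w escape | no w∉Q | _ with pickAvoiding P₃ (y ∷ w ∷ [])
... | p , p∈P , p≢y ∷ p≢w ∷ [] with pickAvoiding Q₂ (p ∷ [])
...   | q , q∈Q , q≢p ∷ [] = record
        { p = p ; q = q ; p∈P = p∈P ; q∈Q = q∈Q ; p≢y = p≢y
        ; p≢w = p≢w ; q≢w = ∈∧∉⇒≢ q∈Q w∉Q ; p≢q = ≢-sym q≢p }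

zSize : J → ℕ
zSize j1 = 2
zSize j2 = 2
zSize j3 = 3
zSize j4 = 4
zSize j5 = 3
zSize j6 = 2
zSize j7 = 3

record DiamondColouring (A : J → List ℕ) (d : ℕ) : Set where
  field
    z₁ z₂ z₃ z₄ : ℕ
    z₁∈ : z₁ ∈ A j1
    z₂∈ : z₂ ∈ A j2
    z₃∈ : z₃ ∈ A j3
    z₄∈ : z₄ ∈ A j4
    z₁≢d  : z₁ ≢ d
    z₂≢d  : z₂ ≢ d
    z₁≢z₃ : z₁ ≢ z₃
    z₁≢z₄ : z₁ ≢ z₄
    z₂≢z₃ : z₂ ≢ z₃
    z₂≢z₄ : z₂ ≢ z₄
    z₃≢z₄ : z₃ ≢ z₄

record ZColouring (A : J → List ℕ) (d c : ℕ) : Set where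
  field
    diamond : DiamondColouring A d
    top     : EdgeColouring (A j5) (A j6) (DiamondColouring.z₄ diamond) c

data DiamondSlack (A : J → List ℕ) (d : ℕ) : Set where
  shared       : ∀ {m} → m ∈ A j1 → m ∈ A j2 → m ≢ d → DiamondSlack A d
  first∉third  : ∀ {a} → a ∈ A j1 → a ∉ A j3 → a ≢ d → DiamondSlack A d
  second∉third : ∀ {e} → e ∈ A j2 → e ∉ A j3 → e ≢ d → DiamondSlack A d

module ZGadget {A : J → List ℕ} (size : ∀ j → Sized (zSize j) (A j)) where

  diamondColouring : ∀ d → DiamondColouring A d
  diamondColouring d with pickAvoiding (size j1) (d ∷ []) | pickAvoiding (size j2) (d ∷ [])
  ... | a , a∈ , a≢d ∷ [] | e , e∈ , e≢d ∷ [] with pickAvoiding (size j3) (a ∷ e ∷ [])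
  ... | x , x∈ , x≢a ∷ x≢e ∷ [] with pickAvoiding (size j4) (a ∷ e ∷ x ∷ [])
  ... | w , w∈ , w≢a ∷ w≢e ∷ w≢x ∷ [] = record
    { z₁ = a ; z₂ = e ; z₃ = x ; z₄ = w ; z₁∈ = a∈ ; z₂∈ = e∈ ; z₃∈ = x∈ ; z₄∈ = w∈
    ; z₁≢d = a≢d ; z₂≢d = e≢d ; z₁≢z₃ = ≢-sym x≢a ; z₁≢z₄ = ≢-sym w≢a
    ; z₂≢z₃ = ≢-sym x≢e ; z₂≢z₄ = ≢-sym w≢e ; z₃≢z₄ = ≢-sym w≢x }

  -- With slack, z₃ effectively sees at most two colours, so z₄ can be chosen before z₃ and also avoid h.
  diamondColouringAvoiding : ∀ {d} → DiamondSlack A d → ∀ h →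
                             Σ (DiamondColouring A d) λ D → DiamondColouring.z₄ D ≢ h
  diamondColouringAvoiding (shared {m} m∈₁ m∈₂ m≢d) h with pickAvoiding (size j3) (m ∷ [])
  ... | x , x∈ , x≢m ∷ [] with pickAvoiding (size j4) (h ∷ m ∷ x ∷ [])
  ... | w , w∈ , w≢h ∷ w≢m ∷ w≢x ∷ [] = record
    { z₁ = m ; z₂ = m ; z₃ = x ; z₄ = w ; z₁∈ = m∈₁ ; z₂∈ = m∈₂ ; z₃∈ = x∈ ; z₄∈ = w∈
    ; z₁≢d = m≢d ; z₂≢d = m≢d ; z₁≢z₃ = ≢-sym x≢m ; z₁≢z₄ = ≢-sym w≢m
    ; z₂≢z₃ = ≢-sym x≢m ; z₂≢z₄ = ≢-sym w≢m ; z₃≢z₄ = ≢-sym w≢x } , w≢h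
  diamondColouringAvoiding {d} (first∉third {a} a∈₁ a∉₃ a≢d) h with pickAvoiding (size j2) (d ∷ [])
  ... | e , e∈ , e≢d ∷ [] with pickAvoiding (size j4) (h ∷ a ∷ e ∷ [])
  ... | w , w∈ , w≢h ∷ w≢a ∷ w≢e ∷ [] with pickAvoiding (size j3) (e ∷ w ∷ [])
  ... | x , x∈ , x≢e ∷ x≢w ∷ [] = record
    { z₁ = a ; z₂ = e ; z₃ = x ; z₄ = w ; z₁∈ = a∈₁ ; z₂∈ = e∈ ; z₃∈ = x∈ ; z₄∈ = w∈
    ; z₁≢d = a≢d ; z₂≢d = e≢d ; z₁≢z₃ = ≢-sym (∈∧∉⇒≢ x∈ a∉₃) ; z₁≢z₄ = ≢-sym w≢a
    ; z₂≢z₃ = ≢-sym x≢e ; z₂≢z₄ = ≢-sym w≢e ; z₃≢z₄ = x≢w } , w≢h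
  diamondColouringAvoiding {d} (second∉third {e} e∈₂ e∉₃ e≢d) h with pickAvoiding (size j1) (d ∷ [])
  ... | a , a∈ , a≢d ∷ [] with pickAvoiding (size j4) (h ∷ a ∷ e ∷ [])
  ... | w , w∈ , w≢h ∷ w≢a ∷ w≢e ∷ [] with pickAvoiding (size j3) (a ∷ w ∷ [])
  ... | x , x∈ , x≢a ∷ x≢w ∷ [] = record
    { z₁ = a ; z₂ = e ; z₃ = x ; z₄ = w ; z₁∈ = a∈ ; z₂∈ = e∈₂ ; z₃∈ = x∈ ; z₄∈ = w∈
    ; z₁≢d = a≢d ; z₂≢d = e≢d ; z₁≢z₃ = ≢-sym x≢a ; z₁≢z₄ = ≢-sym w≢a
    ; z₂≢z₃ = ≢-sym (∈∧∉⇒≢ x∈ e∉₃) ; z₂≢z₄ = ≢-sym w≢e ; z₃≢z₄ = x≢w } , w≢h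

  slack : ∃[ d* ] ∀ d → d ≢ d* → DiamondSlack A d
  slack with any? (_∈? A j2) (A j1)
  ... | yes common = let m , m∈₁ , m∈₂ = find common in
        m , λ d d≢m → shared m∈₁ m∈₂ (≢-sym d≢m)
  ... | no  apart with pickOutside (size₁₂ apart) (proj₂ (size j3))
    where
    size₁₂ : ¬ Any (_∈ A j2) (A j1) → Sized 4 (A j1 ++ A j2)
    size₁₂ apart = ++⁺ (proj₁ (size j1)) (proj₁ (size j2)) (λ (x∈₁ , x∈₂) → apart (lose x∈₁ x∈₂))
                 , trans (length-++ (A j1)) (cong₂ _+_ (proj₂ (size j1)) (proj₂ (size j2)))
  ... | x , x∈₁₂ , x∉₃ = x , [ (λ x∈₁ d d≢x → first∉third x∈₁ x∉₃ (≢-sym d≢x))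
                             , (λ x∈₂ d d≢x → second∉third x∈₂ x∉₃ (≢-sym d≢x)) ]′ (∈-++⁻ (A j1) x∈₁₂)

  zColouring : ∃[ d* ] ∀ d c → d ≢ d* ⊎ c ∉ A j6 → ZColouring A d c
  zColouring with slack | pickOutside (size j5) (proj₂ (size j6))
  ... | d* , slack-off-d* | h , h∈₅ , h∉₆ = d* , colour
    where
    top : ∀ {x} c → x ≢ h ⊎ c ∉ A j6 → EdgeColouring (A j5) (A j6) x c
    top c = edgeColouring (size j5) (size j6) h∈₅ h∉₆ _ c
    colour : ∀ d c → d ≢ d* ⊎ c ∉ A j6 → ZColouring A d c
    colour d c (inj₂ c∉₆)  = record { diamond = diamondColouring d ; top = top c (inj₂ c∉₆) }
    colour d c (inj₁ d≢d*) = let D , z₄≢h = diamondColouringAvoiding (slack-off-d* d d≢d*) h in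
                             record { diamond = D ; top = top c (inj₁ z₄≢h) }

record RimColouring (B₁ B₂ B₃ B₄ B₅ : List ℕ) (y : ℕ) : Set where
  field
    a₁ a₂ a₃ a₄ a₅ : ℕ
    a₁∈ : a₁ ∈ B₁
    a₂∈ : a₂ ∈ B₂
    a₃∈ : a₃ ∈ B₃
    a₄∈ : a₄ ∈ B₄
    a₅∈ : a₅ ∈ B₅
    a₁≢y : a₁ ≢ y
    a₂≢y : a₂ ≢ y
    a₃≢y : a₃ ≢ y
    a₄≢y : a₄ ≢ y
    a₅≢y : a₅ ≢ y
    a₁≢a₂ : a₁ ≢ a₂
    a₂≢a₃ : a₂ ≢ a₃
    a₃≢a₄ : a₃ ≢ a₄
    a₄≢a₅ : a₄ ≢ a₅
    a₅≢a₁ : a₅ ≢ a₁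

rotate : ∀ {B₁ B₂ B₃ B₄ B₅ y} → RimColouring B₂ B₃ B₄ B₅ B₁ y → RimColouring B₁ B₂ B₃ B₄ B₅ y
rotate R = record
  { a₁ = a₅ ; a₂ = a₁ ; a₃ = a₂ ; a₄ = a₃ ; a₅ = a₄
  ; a₁∈ = a₅∈ ; a₂∈ = a₁∈ ; a₃∈ = a₂∈ ; a₄∈ = a₃∈ ; a₅∈ = a₄∈
  ; a₁≢y = a₅≢y ; a₂≢y = a₁≢y ; a₃≢y = a₂≢y ; a₄≢y = a₃≢y ; a₅≢y = a₄≢y
  ; a₁≢a₂ = a₅≢a₁ ; a₂≢a₃ = a₁≢a₂ ; a₃≢a₄ = a₂≢a₃ ; a₄≢a₅ = a₃≢a₄ ; a₅≢a₁ = a₄≢a₅ }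
  where open RimColouring R

-- Greedy round the cycle from B₂ to B₅; the last vertex B₁ then sees only a₅ and a₂, since y ∉ B₁.
rimColouring : ∀ {B₁ B₂ B₃ B₄ B₅ y} → Sized 3 B₁ → Sized 3 B₂ → Sized 3 B₃ → Sized 3 B₄ → Sized 3 B₅ →
               y ∉ B₁ → RimColouring B₁ B₂ B₃ B₄ B₅ y
rimColouring {y = y} s₁ s₂ s₃ s₄ s₅ y∉B₁ with pickAvoiding s₂ (y ∷ [])
... | a₂ , a₂∈ , a₂≢y ∷ [] with pickAvoiding s₃ (y ∷ a₂ ∷ [])
... | a₃ , a₃∈ , a₃≢y ∷ a₃≢a₂ ∷ [] with pickAvoiding s₄ (y ∷ a₃ ∷ [])
... | a₄ , a₄∈ , a₄≢y ∷ a₄≢a₃ ∷ [] with pickAvoiding s₅ (y ∷ a₄ ∷ [])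
... | a₅ , a₅∈ , a₅≢y ∷ a₅≢a₄ ∷ [] with pickAvoiding s₁ (a₅ ∷ a₂ ∷ [])
... | a₁ , a₁∈ , a₁≢a₅ ∷ a₁≢a₂ ∷ [] = record
  { a₁ = a₁ ; a₂ = a₂ ; a₃ = a₃ ; a₄ = a₄ ; a₅ = a₅
  ; a₁∈ = a₁∈ ; a₂∈ = a₂∈ ; a₃∈ = a₃∈ ; a₄∈ = a₄∈ ; a₅∈ = a₅∈
  ; a₁≢y = ∈∧∉⇒≢ a₁∈ y∉B₁ ; a₂≢y = a₂≢y ; a₃≢y = a₃≢y ; a₄≢y = a₄≢y ; a₅≢y = a₅≢y
  ; a₁≢a₂ = a₁≢a₂ ; a₂≢a₃ = ≢-sym a₃≢a₂ ; a₃≢a₄ = ≢-sym a₄≢a₃ ; a₄≢a₅ = ≢-sym a₅≢a₄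
  ; a₅≢a₁ = ≢-sym a₁≢a₅ }

rimColouringExtending : ∀ {B₁ B₂ B₃ B₄ B₅ y a₁ a₃} → Sized 3 B₂ → Sized 3 B₄ → Sized 3 B₅ →
                        a₁ ∈ B₁ → a₃ ∈ B₃ → y ∉ B₁ → y ∉ B₂ → y ∉ B₃ → y ∉ B₄ → y ∉ B₅ →
                        Σ (RimColouring B₁ B₂ B₃ B₄ B₅ y) λ R →
                          RimColouring.a₁ R ≡ a₁ × RimColouring.a₃ R ≡ a₃
rimColouringExtending {a₁ = a₁} {a₃} s₂ s₄ s₅ a₁∈ a₃∈ y∉₁ y∉₂ y∉₃ y∉₄ y∉₅
  with pickAvoiding s₂ (a₁ ∷ a₃ ∷ []) | pickAvoiding s₅ (a₁ ∷ [])
... | a₂ , a₂∈ , a₂≢a₁ ∷ a₂≢a₃ ∷ [] | a₅ , a₅∈ , a₅≢a₁ ∷ [] with pickAvoiding s₄ (a₃ ∷ a₅ ∷ [])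
... | a₄ , a₄∈ , a₄≢a₃ ∷ a₄≢a₅ ∷ [] = record
  { a₁ = a₁ ; a₂ = a₂ ; a₃ = a₃ ; a₄ = a₄ ; a₅ = a₅
  ; a₁∈ = a₁∈ ; a₂∈ = a₂∈ ; a₃∈ = a₃∈ ; a₄∈ = a₄∈ ; a₅∈ = a₅∈
  ; a₁≢y = ∈∧∉⇒≢ a₁∈ y∉₁ ; a₂≢y = ∈∧∉⇒≢ a₂∈ y∉₂ ; a₃≢y = ∈∧∉⇒≢ a₃∈ y∉₃
  ; a₄≢y = ∈∧∉⇒≢ a₄∈ y∉₄ ; a₅≢y = ∈∧∉⇒≢ a₅∈ y∉₅
  ; a₁≢a₂ = ≢-sym a₂≢a₁ ; a₂≢a₃ = a₂≢a₃ ; a₃≢a₄ = ≢-sym a₄≢a₃ ; a₄≢a₅ = a₄≢a₅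
  ; a₅≢a₁ = a₅≢a₁ } , refl , refl

ProperOn : (V → ℕ) → List (V × V) → Set
ProperOn c = All λ e → c (proj₁ e) ≢ c (proj₂ e)

edgewise⇒proper : ∀ c → ProperOn c edgesG3 → ∀ u v → Adj3 u v → c u ≢ c v
edgewise⇒proper c ok u v (inj₁ uv∈) = All.lookup ok uv∈
edgewise⇒proper c ok u v (inj₂ vu∈) = ≢-sym (All.lookup ok vu∈)

-- Being proper and constant on {v1, v3} and on S3, this colouring shows that both pairs are independent.
sample : V → ℕ
sample v1 = 1
sample u2 = 2
sample v3 = 1
sample u4 = 2
sample u5 = 3
sample y1 = 4
sample y2 = 1
sample y3 = 2
sample y4 = 3
sample (z i j1) = 1
sample (z i j2) = 1
sample (z i j3) = 2
sample (z i j4) = 4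
sample (z i j5) = 1
sample (z i j6) = 2
sample (z i j7) = 3

sample-proper : ∀ u v → Adj3 u v → sample u ≢ sample v
sample-proper = edgewise⇒proper sample (All-++⁺ onG2 (All-++⁺ (onZ i1) (onZ i2)))
  where
  onG2 : ProperOn sample edgesG2
  onG2 = (λ ()) ∷ (λ ()) ∷ (λ ()) ∷ (λ ()) ∷ (λ ()) ∷ (λ ()) ∷ (λ ()) ∷
         (λ ()) ∷ (λ ()) ∷ (λ ()) ∷ (λ ()) ∷ (λ ()) ∷ (λ ()) ∷ (λ ()) ∷ []
  onZ : ∀ i → ProperOn sample (edgesZ i)
  onZ i = (λ ()) ∷ (λ ()) ∷ (λ ()) ∷ (λ ()) ∷ (λ ()) ∷ (λ ()) ∷
          (λ ()) ∷ (λ ()) ∷ (λ ()) ∷ (λ ()) ∷ (λ ()) ∷ []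

pairColouring : ∀ {L a b ψ} → sample a ≡ sample b → ψ a ∈ L a → ψ b ∈ L b →
                IsLColoringOn Adj3 L (pair a b) ψ
pairColouring {L} {a} {b} {ψ} same ψa∈ ψb∈ = memberships , λ u v u∈ v∈ adj → ⊥-elim (independent u v u∈ v∈ adj)
  where
  memberships : ∀ v → pair a b v → ψ v ∈ L v
  memberships v (inj₁ refl) = ψa∈
  memberships v (inj₂ refl) = ψb∈
  independent : ∀ u v → pair a b u → pair a b v → ¬ Adj3 u v
  independent u v (inj₁ refl) (inj₁ refl) adj = sample-proper u v adj refl
  independent u v (inj₁ refl) (inj₂ refl) adj = sample-proper u v adj same
  independent u v (inj₂ refl) (inj₁ refl) adj = sample-proper u v adj (sym same)
  independent u v (inj₂ refl) (inj₂ refl) adj = sample-proper u v adj refl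

z₇∈S3 : ∀ i → S3 (z i j7)
z₇∈S3 i1 = inj₁ refl
z₇∈S3 i2 = inj₂ refl

record G3Colouring (L : V → List ℕ) : Set where
  field
    hub      : ℕ
    hub∈     : hub ∈ L y1
    rim      : RimColouring (L v1) (L u2) (L v3) (L u4) (L u5) hub
    y₄       : ℕ
    y₄∈      : y₄ ∈ L y4
    triangle : EdgeColouring (L y2) (L y3) hub y₄
    z₇       : I → ℕ
    z₇∈      : ∀ i → z₇ i ∈ L (z i j7)
    gadget   : ∀ i → ZColouring (L ∘ z i) y₄ (z₇ i)

module _ {L : V → List ℕ} (C : G3Colouring L) where
  open G3Colouring C
  open RimColouring rim
  open EdgeColouring triangle
  private
    module D (i : I) = DiamondColouring (ZColouring.diamond (gadget i))
    module T (i : I) = EdgeColouring (ZColouring.top (gadget i))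

  colouring : V → ℕ
  colouring v1 = a₁
  colouring u2 = a₂
  colouring v3 = a₃
  colouring u4 = a₄
  colouring u5 = a₅
  colouring y1 = hub
  colouring y2 = p
  colouring y3 = q
  colouring y4 = y₄
  colouring (z i j1) = D.z₁ i
  colouring (z i j2) = D.z₂ i
  colouring (z i j3) = D.z₃ i
  colouring (z i j4) = D.z₄ i
  colouring (z i j5) = T.p i
  colouring (z i j6) = T.q i
  colouring (z i j7) = z₇ i

  colouring-isLColoring : IsLColoring Adj3 L colouring
  colouring-isLColoring = lists , edgewise⇒proper colouring (All-++⁺ onG2 (All-++⁺ (onZ i1) (onZ i2)))
    where
    lists : ∀ v → colouring v ∈ L v
    lists v1 = a₁∈
    lists u2 = a₂∈
    lists v3 = a₃∈
    lists u4 = a₄∈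
    lists u5 = a₅∈
    lists y1 = hub∈
    lists y2 = p∈P
    lists y3 = q∈Q
    lists y4 = y₄∈
    lists (z i j1) = D.z₁∈ i
    lists (z i j2) = D.z₂∈ i
    lists (z i j3) = D.z₃∈ i
    lists (z i j4) = D.z₄∈ i
    lists (z i j5) = T.p∈P i
    lists (z i j6) = T.q∈Q i
    lists (z i j7) = z₇∈ i
    onG2 : ProperOn colouring edgesG2
    onG2 = a₁≢a₂ ∷ a₂≢a₃ ∷ a₃≢a₄ ∷ a₄≢a₅ ∷ a₅≢a₁ ∷
           ≢-sym a₁≢y ∷ ≢-sym a₂≢y ∷ ≢-sym a₃≢y ∷ ≢-sym a₄≢y ∷ ≢-sym a₅≢y ∷
           p≢q ∷ q≢w ∷ p≢w ∷ ≢-sym p≢y ∷ []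
    onZ : ∀ i → ProperOn colouring (edgesZ i)
    onZ i = ≢-sym (D.z₁≢d i) ∷ ≢-sym (D.z₂≢d i) ∷ D.z₁≢z₃ i ∷ D.z₁≢z₄ i ∷ D.z₂≢z₃ i ∷
            D.z₂≢z₄ i ∷ D.z₃≢z₄ i ∷ T.p≢q i ∷ T.q≢w i ∷ T.p≢w i ∷ ≢-sym (T.p≢y i) ∷ []

  colouring-agrees : ∀ {ψ} → a₁ ≡ ψ v1 → a₃ ≡ ψ v3 → (∀ i → z₇ i ≡ ψ (z i j7)) →
                     AgreeOn (S3 ∪ pair v1 v3) ψ colouring
  colouring-agrees ≡v1 ≡v3 ≡z₇ v (inj₁ (inj₁ refl)) = sym (≡z₇ i1)
  colouring-agrees ≡v1 ≡v3 ≡z₇ v (inj₁ (inj₂ refl)) = sym (≡z₇ i2)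
  colouring-agrees ≡v1 ≡v3 ≡z₇ v (inj₂ (inj₁ refl)) = sym ≡v1
  colouring-agrees ≡v1 ≡v3 ≡z₇ v (inj₂ (inj₂ refl)) = sym ≡v3

cycle : List V
cycle = v1 ∷ u2 ∷ v3 ∷ u4 ∷ u5 ∷ []

module HalfList (L : V → List ℕ) (half : IsHalfList L3 L) where

  sized : ∀ v → Sized ⌊ length (L3 v) /2⌋ (L v)
  sized v = proj₁ (half v) , trans (n≡⌊n*2/2⌋ _) (cong ⌊_/2⌋ (proj₂ (half v)))

  sized-z : ∀ i j → Sized (zSize j) (L (z i j))
  sized-z i j1 = sized (z i j1)
  sized-z i j2 = sized (z i j2)
  sized-z i j3 = sized (z i j3)
  sized-z i j4 = sized (z i j4)
  sized-z i j5 = sized (z i j5)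
  sized-z i j6 = sized (z i j6)
  sized-z i j7 = sized (z i j7)

  sized-cycle : ∀ {v} → v ∈ cycle → Sized 3 (L v)
  sized-cycle (here refl)                                 = sized v1
  sized-cycle (there (here refl))                         = sized u2
  sized-cycle (there (there (here refl)))                 = sized v3
  sized-cycle (there (there (there (here refl))))         = sized u4
  sized-cycle (there (there (there (there (here refl))))) = sized u5

  rimMissing : ∀ {y v} → v ∈ cycle → y ∉ L v → RimColouring (L v1) (L u2) (L v3) (L u4) (L u5) y
  rimMissing (here refl) =
    rimColouring (sized v1) (sized u2) (sized v3) (sized u4) (sized u5)
  rimMissing (there (here refl)) =
    rotate ∘ rimColouring (sized u2) (sized v3) (sized u4) (sized u5) (sized v1)
  rimMissing (there (there (here refl))) =
    rotate ∘ rotate ∘ rimColouring (sized v3) (sized u4) (sized u5) (sized v1) (sized u2)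
  rimMissing (there (there (there (here refl)))) =
    rotate ∘ rotate ∘ rotate ∘ rimColouring (sized u4) (sized u5) (sized v1) (sized u2) (sized v3)
  rimMissing (there (there (there (there (here refl))))) =
    rotate ∘ rotate ∘ rotate ∘ rotate ∘ rimColouring (sized u5) (sized v1) (sized u2) (sized v3) (sized u4)

  module Gadget (i : I) = ZGadget (sized-z i)

  d* : I → ℕ
  d* i = proj₁ (Gadget.zColouring i)

  gadgetColouring : ∀ i d c → d ≢ d* i ⊎ c ∉ L (z i j6) → ZColouring (L ∘ z i) d c
  gadgetColouring i = proj₂ (Gadget.zColouring i)

  Extendable : VSet V → (V → ℕ) → Set
  Extendable T ψ₀ = ∀ ψ → IsLColoringOn Adj3 L (S3 ∪ pair v1 v3) ψ → AgreeOn T ψ₀ ψ →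
                    Σ (V → ℕ) λ c → IsLColoring Adj3 L c × AgreeOn (S3 ∪ pair v1 v3) ψ c

  hubCases : ∀ r → (∃[ y ] y ∈ L y1 × y ≢ r × ∃[ v ] v ∈ cycle × y ∉ L v)
                 ⊎ (∀ {v} → v ∈ cycle → L y1 ⊆ r ∷ L v)
  hubCases r with any? (λ v → any? (λ y → y ∉? r ∷ L v) (L y1)) cycle
  ... | no none = inj₂ λ v∈ y∈ → decidable-stable (_ ∈? _) (none ∘ lose v∈ ∘ lose y∈)
  ... | yes some with find some
  ...   | v , v∈ , some′ with find some′
  ...     | y , y∈ , y∉ = inj₁ (y , y∈ , y∉ ∘ here , v , v∈ , y∉ ∘ there)

  hubOffRim : ∀ {r y} → r ∈ L y2 → r ∉ L y3 → y ∈ L y1 → y ≢ r →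
              RimColouring (L v1) (L u2) (L v3) (L u4) (L u5) y →
              Σ (V → ℕ) λ ψ₀ → IsLColoringOn Adj3 L (pair v1 v3) ψ₀ × Extendable (pair v1 v3) ψ₀
  hubOffRim {r} {y} r∈y2 r∉y3 y∈ y≢r R with pickAvoiding (sized y4) (d* i1 ∷ d* i2 ∷ [])
  ... | w , w∈ , w≢d₁ ∷ w≢d₂ ∷ [] = ψ₀ , pairColouring refl a₁∈ a₃∈ , extend
    where
    open RimColouring R
    ψ₀ : V → ℕ
    ψ₀ v1 = a₁
    ψ₀ v3 = a₃
    ψ₀ _  = 0
    w≢d* : ∀ i → w ≢ d* i
    w≢d* i1 = w≢d₁
    w≢d* i2 = w≢d₂
    extend : Extendable (pair v1 v3) ψ₀
    extend ψ ψ-col ψ₀≈ψ =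
      colouring C , colouring-isLColoring C ,
      colouring-agrees C (ψ₀≈ψ v1 (inj₁ refl)) (ψ₀≈ψ v3 (inj₂ refl)) (λ _ → refl)
      where
      C : G3Colouring L
      C = record
        { hub = y ; hub∈ = y∈ ; rim = R ; y₄ = w ; y₄∈ = w∈
        ; triangle = edgeColouring (sized y2) (sized y3) r∈y2 r∉y3 y w (inj₁ y≢r)
        ; z₇ = λ i → ψ (z i j7) ; z₇∈ = λ i → proj₁ ψ-col (z i j7) (inj₁ (z₇∈S3 i))
        ; gadget = λ i → gadgetColouring i w (ψ (z i j7)) (inj₁ (w≢d* i)) }

  hubOnRim : ∀ {r} → r ∈ L y2 → r ∉ L y3 → (∀ {v} → v ∈ cycle → L y1 ⊆ r ∷ L v) →
             SameSet (L v1) (L v3) × Σ (V → ℕ) λ ψ₀ → IsLColoringOn Adj3 L S3 ψ₀ × Extendable S3 ψ₀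
  hubOnRim {r} r∈y2 r∉y3 covered = sameSet , ψ₀ , pairColouring refl (c*∈ i1) (c*∈ i2) , extend
    where
    tight : ∀ {v} → v ∈ cycle → r ∉ L v × r ∷ L v ⊆ L y1
    tight v∈ = ⊆-∷⇒∉×⊇ (sized y1) (proj₂ (sized-cycle v∈)) (covered v∈)
    rim⊆rim : ∀ {v v′} → v ∈ cycle → v′ ∈ cycle → L v ⊆ L v′
    rim⊆rim v∈ v′∈ x∈ with covered v′∈ (proj₂ (tight v∈) (there x∈))
    ... | here refl = contradiction x∈ (proj₁ (tight v∈))
    ... | there x∈′ = x∈′
    v3∈cycle : v3 ∈ cycle
    v3∈cycle = there (there (here refl))
    sameSet : SameSet (L v1) (L v3)
    sameSet _ = rim⊆rim (here refl) v3∈cycle , rim⊆rim v3∈cycle (here refl)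
    outsideZ₆ : ∀ i → ∃[ c ] c ∈ L (z i j7) × c ∉ L (z i j6)
    outsideZ₆ i = pickOutside (sized-z i j7) (proj₂ (sized-z i j6))
    c* : I → ℕ
    c* i = proj₁ (outsideZ₆ i)
    c*∈ : ∀ i → c* i ∈ L (z i j7)
    c*∈ i = proj₁ (proj₂ (outsideZ₆ i))
    ψ₀ : V → ℕ
    ψ₀ (z i j7) = c* i
    ψ₀ _        = 0
    extend : Extendable S3 ψ₀
    extend ψ ψ-col ψ₀≈ψ with All.tabulate {xs = cycle} (proj₁ ∘ tight)
    ... | r∉v1 ∷ r∉u2 ∷ r∉v3 ∷ r∉u4 ∷ r∉u5 ∷ []
      with rimColouringExtending (sized u2) (sized u4) (sized u5)
             (proj₁ ψ-col v1 (inj₂ (inj₁ refl))) (proj₁ ψ-col v3 (inj₂ (inj₂ refl)))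
             r∉v1 r∉u2 r∉v3 r∉u4 r∉u5
         | pickOutside (sized y4) (proj₂ (sized y3))
    ... | R , a₁≡ψv1 , a₃≡ψv3 | w , w∈ , w∉y3 =
      colouring C , colouring-isLColoring C , colouring-agrees C a₁≡ψv1 a₃≡ψv3 (λ _ → refl)
      where
      ψz₇∉z₆ : ∀ i → ψ (z i j7) ∉ L (z i j6)
      ψz₇∉z₆ i = subst (_∉ L (z i j6)) (ψ₀≈ψ (z i j7) (z₇∈S3 i)) (proj₂ (proj₂ (outsideZ₆ i)))
      C : G3Colouring L
      C = record
        { hub = r ; hub∈ = proj₂ (tight (here refl)) (here refl) ; rim = R ; y₄ = w ; y₄∈ = w∈
        ; triangle = edgeColouring (sized y2) (sized y3) r∈y2 r∉y3 r w (inj₂ w∉y3)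
        ; z₇ = λ i → ψ (z i j7) ; z₇∈ = λ i → proj₁ ψ-col (z i j7) (inj₁ (z₇∈S3 i))
        ; gadget = λ i → gadgetColouring i w (ψ (z i j7)) (inj₂ (ψz₇∉z₆ i)) }

  relaxedFor : (Σ (V → ℕ) λ ψ₀ → IsLColoringOn Adj3 L (pair v1 v3) ψ₀ × Extendable (pair v1 v3) ψ₀)
             ⊎ (SameSet (L v1) (L v3) × Σ (V → ℕ) λ ψ₀ → IsLColoringOn Adj3 L S3 ψ₀ × Extendable S3 ψ₀)
  relaxedFor with pickOutside (sized y2) (proj₂ (sized y3))
  ... | r , r∈y2 , r∉y3 with hubCases r
  ...   | inj₁ (y , y∈ , y≢r , v , v∈ , y∉) = inj₁ (hubOffRim r∈y2 r∉y3 y∈ y≢r (rimMissing v∈ y∉))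
  ...   | inj₂ covered                      = inj₂ (hubOnRim r∈y2 r∉y3 covered)

relaxed : Relaxed Adj3 L3 v1 v3 S3
relaxed = HalfList.relaxedFor

edge₂ : (k : Fin 14) → Adj3 (proj₁ (lookup edgesG2 k)) (proj₂ (lookup edgesG2 k))
edge₂ k = inj₁ (∈-++⁺ˡ (∈-lookup {xs = edgesG2} k))

edgeᶻ : ∀ i (k : Fin 11) → Adj3 (proj₁ (lookup (edgesZ i) k)) (proj₂ (lookup (edgesZ i) k))
edgeᶻ i1 k = inj₁ (∈-++⁺ʳ edgesG2 (∈-++⁺ˡ (∈-lookup {xs = edgesZ i1} k)))
edgeᶻ i2 k = inj₁ (∈-++⁺ʳ edgesG2 (∈-++⁺ʳ (edgesZ i1) (∈-lookup {xs = edgesZ i2} k)))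

1-3#4-6 : Disjoint (1 ∷ 2 ∷ 3 ∷ []) (4 ∷ 5 ∷ 6 ∷ [])
1-3#4-6 (here refl , there (there (there ())))
1-3#4-6 (there (here refl) , there (there (there ())))
1-3#4-6 (there (there (here refl)) , there (there (there ())))

1-4#7-8 : Disjoint (1 ∷ 2 ∷ 3 ∷ 4 ∷ []) (7 ∷ 8 ∷ [])
1-4#7-8 (there (there (there (there ()))) , here refl)
1-4#7-8 (there (there (there (there ()))) , there (here refl))

⊆-pair⇒≡ : ∀ {a b x y : ℕ} → a < b → x < y → x ∷ y ∷ [] ⊆ a ∷ b ∷ [] → (a , b) ≡ (x , y)
⊆-pair⇒≡ a<b x<y xy⊆ab with xy⊆ab (here refl) | xy⊆ab (there (here refl))
... | here refl         | there (here refl) = refl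
... | here refl         | here refl         = ⊥-elim (<-irrefl refl x<y)
... | there (here refl) | there (here refl) = ⊥-elim (<-irrefl refl x<y)
... | there (here refl) | here refl         = ⊥-elim (<-asym a<b x<y)

module TwoColouring (φ : V → ℕ × ℕ) (C : Is2Coloring Adj3 L3 φ) where

  colours : V → List ℕ
  colours v = proj₁ (φ v) ∷ proj₂ (φ v) ∷ []

  ordered : ∀ v → proj₁ (φ v) < proj₂ (φ v)
  ordered v = proj₁ (proj₁ C v)

  colours-unique : ∀ v → Unique (colours v)
  colours-unique v = (<⇒≢ (ordered v) ∷ []) ∷ [] ∷ []

  colours⊆ : ∀ v → colours v ⊆ L3 v
  colours⊆ v (here refl)         = proj₁ (proj₂ (proj₁ C v))
  colours⊆ v (there (here refl)) = proj₂ (proj₂ (proj₁ C v))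

  colours-disjoint : ∀ {u v} → Adj3 u v → Disjoint (colours u) (colours v)
  colours-disjoint {u} {v} adj (x∈u , x∈v) = proj₂ C u v adj _ (∈-pair⁻ x∈u) (∈-pair⁻ x∈v)
    where
    ∈-pair⁻ : ∀ {x a b : ℕ} → x ∈ a ∷ b ∷ [] → x ≡ a ⊎ x ≡ b
    ∈-pair⁻ (here x≡a)         = inj₁ x≡a
    ∈-pair⁻ (there (here x≡b)) = inj₂ x≡b

  excluded : ∀ {u v x} → Adj3 u v → x ∈ colours u → x ∉ colours v
  excluded adj x∈u x∈v = colours-disjoint adj (x∈u , x∈v)

  triangle-∈ : ∀ {R u v w x} → length R ≤ 6 → Adj3 u v → Adj3 u w → Adj3 v w →
               colours u ⊆ R → colours v ⊆ R → colours w ⊆ R →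
               x ∈ R → x ∉ colours u → x ∉ colours v → x ∈ colours w
  triangle-∈ {u = u} {v} {w} ∣R∣≤6 uv uw vw u⊆R v⊆R w⊆R =
    ∈-third (colours-unique u) (colours-unique v) (colours-unique w)
            (colours-disjoint uv) (colours-disjoint uw) (colours-disjoint vw) u⊆R v⊆R w⊆R ∣R∣≤6

  -- Otherwise {u2, v3, y1} and {u5, u4, y1} both partition {1,…,6}, forcing a colour of v1 onto v3 and u4.
  hub-meets-78 : ∃[ t ] t ∈ colours y1 × t ∈ 7 ∷ 8 ∷ []
  hub-meets-78 with ⊆-or-∃∉ (colours y1) (L3 v1)
  ... | inj₂ (t , t∈y1 , t∉R₆) = t , t∈y1 , ∈-++⁻-∉ˡ (L3 v1) (colours⊆ y1 t∈y1) t∉R₆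
  ... | inj₁ y1⊆R₆ = ⊥-elim (excluded (edge₂ (# 2)) x∈v3 x∈u4)
    where
    x∈v3 : proj₁ (φ v1) ∈ colours v3
    x∈v3 = triangle-∈ ≤-refl (swap (edge₂ (# 6))) (edge₂ (# 1)) (edge₂ (# 7))
             (colours⊆ u2) y1⊆R₆ (colours⊆ v3) (colours⊆ v1 (here refl))
             (excluded (edge₂ (# 0)) (here refl)) (excluded (swap (edge₂ (# 5))) (here refl))
    x∈u4 : proj₁ (φ v1) ∈ colours u4
    x∈u4 = triangle-∈ ≤-refl (swap (edge₂ (# 9))) (swap (edge₂ (# 3))) (edge₂ (# 8))
             (colours⊆ u5) y1⊆R₆ (colours⊆ u4) (colours⊆ v1 (here refl))
             (excluded (swap (edge₂ (# 4))) (here refl)) (excluded (swap (edge₂ (# 5))) (here refl))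

  y4-meets-78 : ∃[ t ] t ∈ colours y4 × t ∈ 7 ∷ 8 ∷ []
  y4-meets-78 with hub-meets-78
  ... | t , t∈y1 , t∈78 = t , t∈y4 , t∈78
    where
    t∈y4 : t ∈ colours y4
    t∈y4 = triangle-∈ ≤-refl (edge₂ (# 10)) (edge₂ (# 12)) (edge₂ (# 11))
             (colours⊆ y2) (∈-++⁺ˡ ∘ colours⊆ y3) (colours⊆ y4) (∈-++⁺ʳ (1 ∷ 2 ∷ 3 ∷ 4 ∷ []) t∈78)
             (excluded (edge₂ (# 13)) t∈y1) (λ t∈y3 → 1-4#7-8 (colours⊆ y3 t∈y3 , t∈78))

  gadget-forces-78 : ∀ i → 6 + idx i ∈ colours y4 → φ (z i j7) ≡ (7 , 8)
  gadget-forces-78 i T∈y4 = ⊆-pair⇒≡ (ordered (z i j7)) (s≤s ≤-refl) 78⊆z₇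
    where
    z₁⊆ : colours (z i j1) ⊆ 1 ∷ 2 ∷ 3 ∷ []
    z₁⊆ x∈z₁ = ∈-++⁻-∉ʳ (1 ∷ 2 ∷ 3 ∷ []) (colours⊆ (z i j1) x∈z₁)
                 λ { (here refl) → excluded (edgeᶻ i (# 0)) T∈y4 x∈z₁ }
    z₂⊆ : colours (z i j2) ⊆ 4 ∷ 5 ∷ 6 ∷ []
    z₂⊆ x∈z₂ = ∈-++⁻-∉ʳ (4 ∷ 5 ∷ 6 ∷ []) (colours⊆ (z i j2) x∈z₂)
                 λ { (here refl) → excluded (edgeᶻ i (# 1)) T∈y4 x∈z₂ }
    z₄⊆78 : colours (z i j4) ⊆ 7 ∷ 8 ∷ []
    z₄⊆78 x∈z₄ = ∈-++⁻-∉ˡ (L3 v1) (colours⊆ (z i j4) x∈z₄) λ x∈R₆ →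
      excluded (edgeᶻ i (# 6))
        (∈-third (colours-unique (z i j1)) (colours-unique (z i j2)) (colours-unique (z i j3))
                 (λ (x∈z₁ , x∈z₂) → 1-3#4-6 (z₁⊆ x∈z₁ , z₂⊆ x∈z₂))
                 (colours-disjoint (edgeᶻ i (# 2))) (colours-disjoint (edgeᶻ i (# 4)))
                 (∈-++⁺ˡ ∘ z₁⊆) (∈-++⁺ʳ (1 ∷ 2 ∷ 3 ∷ []) ∘ z₂⊆) (colours⊆ (z i j3)) ≤-refl
                 x∈R₆ (λ x∈z₁ → excluded (edgeᶻ i (# 3)) x∈z₁ x∈z₄) (λ x∈z₂ → excluded (edgeᶻ i (# 5)) x∈z₂ x∈z₄))
        x∈z₄
    78⊆z₄ : 7 ∷ 8 ∷ [] ⊆ colours (z i j4)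
    78⊆z₄ = ⊆∧length≤⇒⊇ (colours-unique (z i j4)) z₄⊆78 ≤-refl
    78⊆z₇ : 7 ∷ 8 ∷ [] ⊆ colours (z i j7)
    78⊆z₇ t∈78 = triangle-∈ ≤-refl (edgeᶻ i (# 7)) (edgeᶻ i (# 9)) (edgeᶻ i (# 8))
                   (colours⊆ (z i j5)) (∈-++⁺ˡ ∘ colours⊆ (z i j6)) (colours⊆ (z i j7))
                   (∈-++⁺ʳ (1 ∷ 2 ∷ 3 ∷ 4 ∷ []) t∈78)
                   (excluded (edgeᶻ i (# 10)) (78⊆z₄ t∈78)) (λ t∈z₆ → 1-4#7-8 (colours⊆ (z i j6) t∈z₆ , t∈78))

  gadget-coloured-78 : φ (z i1 j7) ≡ (7 , 8) ⊎ φ (z i2 j7) ≡ (7 , 8)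
  gadget-coloured-78 with y4-meets-78
  ... | _ , t∈y4 , here refl         = inj₁ (gadget-forces-78 i1 t∈y4)
  ... | _ , t∈y4 , there (here refl) = inj₂ (gadget-forces-78 i2 t∈y4)

lemma6 : Relaxed Adj3 L3 v1 v3 S3 ×
         (∀ (φ : V → ℕ × ℕ) → Is2Coloring Adj3 L3 φ →
            (φ (z i1 j7) ≡ (7 , 8)) ⊎ (φ (z i2 j7) ≡ (7 , 8)))
lemma6 = relaxed , TwoColouring.gadget-coloured-78
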